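{- $\mathsf{Seq}$ is an extension of $\mathsf{WSeq}$: for every formula $\phi$ of the language $\{e,\vdash,\circ\}$, if $\mathsf{WSeq}\vdash\phi$ then $\mathsf{Seq}\vdash\phi$.
   Context: Language $\{e,\ \vdash,\ \circ\}$: $e$ constant, $\vdash$ and $\circ$ binary function symbols ($x\vdash y$ is a term, not provability). $\mathsf{Seq}$ has axioms: $\mathsf{Seq}_1$: $\forall x y\, [x\vdash y\neq e]$; $\mathsf{Seq}_2$: $\forall x_1x_2y_1y_2\,[x_1\vdash x_2=y_1\vdash y_2\rightarrow (x_1=y_1\wedge x_2=y_2)]$; $\mathsf{Seq}_3$: $\forall x\,[x\circ e=x]$; $\mathsf{Seq}_4$: $\forall xyz\,[x\circ(y\vdash z)=(x\circ y)\vdash z]$; $\mathsf{Seq}_5$: $\forall x\,[x=e\vee\exists yz\,[x=y\vdash z]]$. Sequences: $()$ is a sequence, and if $s_1,\dots,s_n$ ($n>0$) are sequences then $(s_1,\dots,s_n)$ is a sequence. The sequeral $\overline{s}$ is the closed term with $\overline{()}=e$ and $\overline{(s_1,\dots,s_n)}=(\cdots((e\vdash\overline{s_1})\vdash\overline{s_2})\cdots)\vdash\overline{s_n}$. $x\sqsubseteq t$ abbreviates $\exists y[x\circ y=t]$. $\mathsf{WSeq}$ is given by the axiom schemes: ($\mathsf{WSeq}_1$) $\overline{s}\neq\overline{t}$ for all distinct sequences $s,t$; ($\mathsf{WSeq}_2$) $\overline{(s_1,\dots,s_n)}\circ\overline{(t_1,\dots,t_m)}=\overline{(s_1,\dots,s_n,t_1,\dots,t_m)}$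 for all sequences; ($\mathsf{WSeq}_3$) $\forall x[x\sqsubseteq\overline{s}\rightarrow\bigvee_{t\in I(s)}x=\overline{t}]$ for each sequence $s$, where $I(s)$ is the set of initial segments of $s$. -}

module Defs where

open import Data.Nat using (ℕ; zero; suc)
open import Data.List using (List; []; _∷_; _++_; take; length; foldr; map)
open import Data.List.Base using (upTo)
open import Relation.Binary.PropositionalEquality using (_≢_)

infixl 7 _⊢ₜ_ _∘ₜ_

data Term : Set where
  var   : ℕ → Term
  e     : Term
  _⊢ₜ_  : Term → Term → Term   -- the binary function symbol ⊢ (a term, not provability)
  _∘ₜ_  : Term → Term → Term

infix 6 _≐_
infixr 4 _⇒_

data Formula : Set where
  ⊥'   : Formula
  _≐_  : Term → Term → Formula
  _⇒_  : Formula → Formula → Formula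
  ∀'   : Formula → Formula

¬' : Formula → Formula
¬' φ = φ ⇒ ⊥'

infixr 5 _∨'_
infixr 5 _∧'_
_∨'_ : Formula → Formula → Formula
φ ∨' ψ = ¬' φ ⇒ ψ

_∧'_ : Formula → Formula → Formula
φ ∧' ψ = ¬' (φ ⇒ ¬' ψ)

∃' : Formula → Formula
∃' φ = ¬' (∀' (¬' φ))

⋁ : List Formula → Formula
⋁ = foldr _∨'_ ⊥'

Subst : Set
Subst = ℕ → Term

substT : Subst → Term → Term
substT σ (var n)  = σ n
substT σ e        = e
substT σ (s ⊢ₜ t) = substT σ s ⊢ₜ substT σ t
substT σ (s ∘ₜ t) = substT σ s ∘ₜ substT σ t

shiftT : Term → Term
shiftT = substT (λ n → var (suc n))

exts : Subst → Subst
exts σ zero    = var zero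
exts σ (suc n) = shiftT (σ n)

substF : Subst → Formula → Formula
substF σ ⊥'       = ⊥'
substF σ (s ≐ t)  = substT σ s ≐ substT σ t
substF σ (φ ⇒ ψ)  = substF σ φ ⇒ substF σ ψ
substF σ (∀' φ)   = ∀' (substF (exts σ) φ)

↑ : Formula → Formula
↑ = substF (λ n → var (suc n))

single : Term → Subst
single t zero    = t
single t (suc n) = var n

_[_] : Formula → Term → Formula
φ [ t ] = substF (single t) φ

-- A theory is a predicate on formulas (its axioms); the
-- theories considered here consist of sentences, so the
-- generalisation rule is unrestricted.

Theory : Set₁
Theory = Formula → Set

infix 2 _⊢_

data _⊢_ (T : Theory) : Formula → Set where
  ax    : ∀ {φ} → T φ → T ⊢ φ
  ax-K  : ∀ {φ ψ} → T ⊢ φ ⇒ ψ ⇒ φ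
  ax-S  : ∀ {φ ψ χ} → T ⊢ (φ ⇒ ψ ⇒ χ) ⇒ (φ ⇒ ψ) ⇒ φ ⇒ χ
  ax-DN : ∀ {φ} → T ⊢ ¬' (¬' φ) ⇒ φ
  ax-∀E : ∀ {φ} (t : Term) → T ⊢ ∀' φ ⇒ φ [ t ]
  ax-∀D : ∀ {φ ψ} → T ⊢ ∀' (↑ φ ⇒ ψ) ⇒ φ ⇒ ∀' ψ
  ax-≐R : ∀ (t : Term) → T ⊢ t ≐ t
  ax-≐L : ∀ {φ} (s t : Term) → T ⊢ s ≐ t ⇒ φ [ s ] ⇒ φ [ t ]
  mp    : ∀ {φ ψ} → T ⊢ φ ⇒ ψ → T ⊢ φ → T ⊢ ψ
  gen   : ∀ {φ} → T ⊢ φ → T ⊢ ∀' φ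

-- The theory Seq  (in binders, index 0 is the innermost variable)

data Seq : Theory where
  seq₁ : Seq (∀' (∀' (¬' ((var 1 ⊢ₜ var 0) ≐ e))))
  seq₂ : Seq (∀' (∀' (∀' (∀'
           (((var 3 ⊢ₜ var 2) ≐ (var 1 ⊢ₜ var 0))
             ⇒ ((var 3 ≐ var 1) ∧' (var 2 ≐ var 0)))))))
  seq₃ : Seq (∀' ((var 0 ∘ₜ e) ≐ var 0))
  seq₄ : Seq (∀' (∀' (∀'
           ((var 2 ∘ₜ (var 1 ⊢ₜ var 0)) ≐ ((var 2 ∘ₜ var 1) ⊢ₜ var 0)))))
  seq₅ : Seq (∀' ((var 0 ≐ e) ∨' ∃' (∃' (var 2 ≐ (var 1 ⊢ₜ var 0)))))

-- Sequences (finite rose trees): node [] is (), node (s₁ ∷ … ∷ sₙ ∷ [])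
-- is (s₁,…,sₙ).

data Sequence : Set where
  node : List Sequence → Sequence

mutual
  ⌜_⌝ : Sequence → Term
  ⌜ node ss ⌝ = ⌜ ss ⌝from e

  ⌜_⌝from_ : List Sequence → Term → Term
  ⌜ [] ⌝from acc     = acc
  ⌜ s ∷ ss ⌝from acc = ⌜ ss ⌝from (acc ⊢ₜ ⌜ s ⌝)

I : Sequence → List Sequence
I (node ss) = map (λ k → node (take k ss)) (upTo (suc (length ss)))

_⊑_ : Term → Term → Formula
x ⊑ t = ∃' ((shiftT x ∘ₜ var 0) ≐ shiftT t)

data WSeq : Theory where
  wseq₁ : ∀ (s t : Sequence) → s ≢ t → WSeq (¬' (⌜ s ⌝ ≐ ⌜ t ⌝))
  wseq₂ : ∀ (ss ts : List Sequence) →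
          WSeq ((⌜ node ss ⌝ ∘ₜ ⌜ node ts ⌝) ≐ ⌜ node (ss ++ ts) ⌝)
  wseq₃ : ∀ (s : Sequence) →
          WSeq (∀' ((var 0 ⊑ ⌜ s ⌝) ⇒ ⋁ (map (λ t → var 0 ≐ ⌜ t ⌝) (I s))))

-- Every axiom of WSeq is a theorem of Seq; the rest is induction on derivations.
-- Sequerals are read from their right end, where ⌜ (s₁,…,sₙ,x) ⌝ = ⌜ (s₁,…,sₙ) ⌝ ⊢ ⌜ x ⌝.
-- WSeq₂ follows from Seq₃ and Seq₄ by induction on the second sequence.
-- WSeq₁: Seq₁ separates () from non-empty sequences, and Seq₂ reduces the comparison
-- of (xs,x) and (ys,y) to that of xs with ys and of x with y (recursion on the rose tree).
-- WSeq₃: if x ∘ y = ⌜ s ⌝, split y by Seq₅.  If y = e then x = ⌜ s ⌝ by Seq₃; if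
-- y = y₁ ⊢ y₂ then (x ∘ y₁) ⊢ y₂ = ⌜ s ⌝ by Seq₄, so s = (s',z) by Seq₁ and
-- x ∘ y₁ = ⌜ s' ⌝ by Seq₂, and x is an initial segment of s' by induction.
module Submission where

open import Defs
open import Data.Nat using (zero; suc; _≤_; s≤s)
open import Data.Nat.Properties using (≤-refl; ≤-trans)
open import Data.List using (List; []; _∷_; _++_; _∷ʳ_; take; length; map)
open import Data.List.Base using (upTo)
open import Data.List.Properties using (take-all; length-++-≤ˡ)
open import Data.List.Reverse using (Reverse; []; _∶_∶ʳ_; reverseView)
open import Data.List.Membership.Propositional using (_∈_)
open import Data.List.Membership.Propositional.Properties using (∈-map⁺; ∈-map⁻; ∈-upTo⁺; ∈-upTo⁻)
open import Data.List.Relation.Unary.Any using (here; there)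
open import Data.List.Relation.Unary.All using (All; []; _∷_)
open import Data.List.Relation.Unary.All.Properties using (++⁻)
open import Data.Product using (_,_)
open import Data.Sum using (_⊎_; inj₁; inj₂; map₁)
open import Data.Empty using (⊥-elim)
open import Relation.Binary.PropositionalEquality
  using (_≡_; _≢_; refl; sym; trans; cong; cong₂; subst; subst₂)

infixr 5 _∷ₛ_

_∷ₛ_ : Term → Subst → Subst
(t ∷ₛ σ) zero    = t
(t ∷ₛ σ) (suc n) = σ n

_⊙_ : Subst → Subst → Subst
(σ ⊙ τ) n = substT σ (τ n)

substT-ext : ∀ {σ τ} → (∀ n → σ n ≡ τ n) → ∀ u → substT σ u ≡ substT τ u
substT-ext h (var n)  = h n
substT-ext h e        = refl
substT-ext h (s ⊢ₜ t) = cong₂ _⊢ₜ_ (substT-ext h s) (substT-ext h t)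
substT-ext h (s ∘ₜ t) = cong₂ _∘ₜ_ (substT-ext h s) (substT-ext h t)

substT-fusion : ∀ σ τ u → substT σ (substT τ u) ≡ substT (σ ⊙ τ) u
substT-fusion σ τ (var n)  = refl
substT-fusion σ τ e        = refl
substT-fusion σ τ (s ⊢ₜ t) = cong₂ _⊢ₜ_ (substT-fusion σ τ s) (substT-fusion σ τ t)
substT-fusion σ τ (s ∘ₜ t) = cong₂ _∘ₜ_ (substT-fusion σ τ s) (substT-fusion σ τ t)

substT-id : ∀ u → substT var u ≡ u
substT-id (var n)  = refl
substT-id e        = refl
substT-id (s ⊢ₜ t) = cong₂ _⊢ₜ_ (substT-id s) (substT-id t)
substT-id (s ∘ₜ t) = cong₂ _∘ₜ_ (substT-id s) (substT-id t)

substT-single-shiftT : ∀ s u → substT (single s) (shiftT u) ≡ u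
substT-single-shiftT s u = trans (substT-fusion (single s) _ u) (substT-id u)

substT-exts-shiftT : ∀ σ u → substT (exts σ) (shiftT u) ≡ shiftT (substT σ u)
substT-exts-shiftT σ u =
  trans (substT-fusion (exts σ) _ u) (sym (substT-fusion (λ n → var (suc n)) σ u))

exts-ext : ∀ {σ τ} → (∀ n → σ n ≡ τ n) → ∀ n → exts σ n ≡ exts τ n
exts-ext h zero    = refl
exts-ext h (suc n) = cong shiftT (h n)

exts-⊙ : ∀ σ τ n → (exts σ ⊙ exts τ) n ≡ exts (σ ⊙ τ) n
exts-⊙ σ τ zero    = refl
exts-⊙ σ τ (suc n) = substT-exts-shiftT σ (τ n)

substF-ext : ∀ {σ τ} → (∀ n → σ n ≡ τ n) → ∀ φ → substF σ φ ≡ substF τ φ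
substF-ext h ⊥'      = refl
substF-ext h (s ≐ t) = cong₂ _≐_ (substT-ext h s) (substT-ext h t)
substF-ext h (φ ⇒ ψ) = cong₂ _⇒_ (substF-ext h φ) (substF-ext h ψ)
substF-ext h (∀' φ)  = cong ∀' (substF-ext (exts-ext h) φ)

substF-fusion : ∀ σ τ φ → substF σ (substF τ φ) ≡ substF (σ ⊙ τ) φ
substF-fusion σ τ ⊥'      = refl
substF-fusion σ τ (s ≐ t) = cong₂ _≐_ (substT-fusion σ τ s) (substT-fusion σ τ t)
substF-fusion σ τ (φ ⇒ ψ) = cong₂ _⇒_ (substF-fusion σ τ φ) (substF-fusion σ τ ψ)
substF-fusion σ τ (∀' φ)  =
  cong ∀' (trans (substF-fusion (exts σ) (exts τ) φ) (substF-ext (exts-⊙ σ τ) φ))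

substF-id : ∀ {σ} → (∀ n → σ n ≡ var n) → ∀ φ → substF σ φ ≡ φ
substF-id h ⊥'      = refl
substF-id h (s ≐ t) =
  cong₂ _≐_ (trans (substT-ext h s) (substT-id s)) (trans (substT-ext h t) (substT-id t))
substF-id h (φ ⇒ ψ) = cong₂ _⇒_ (substF-id h φ) (substF-id h ψ)
substF-id h (∀' φ)  = cong ∀' (substF-id (λ n → trans (exts-ext h n) (exts-var n)) φ)
  where
  exts-var : ∀ n → exts var n ≡ var n
  exts-var zero    = refl
  exts-var (suc n) = refl

mutual
  substT-⌜⌝ : ∀ σ s → substT σ ⌜ s ⌝ ≡ ⌜ s ⌝
  substT-⌜⌝ σ (node ss) = substT-⌜⌝from σ ss e

  substT-⌜⌝from : ∀ σ ss a → substT σ (⌜ ss ⌝from a) ≡ ⌜ ss ⌝from (substT σ a)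
  substT-⌜⌝from σ []       a = refl
  substT-⌜⌝from σ (s ∷ ss) a = trans (substT-⌜⌝from σ ss (a ⊢ₜ ⌜ s ⌝))
    (cong (λ u → ⌜ ss ⌝from (substT σ a ⊢ₜ u)) (substT-⌜⌝ σ s))

⌜⌝from-++ : ∀ ss ts a → ⌜ ss ++ ts ⌝from a ≡ ⌜ ts ⌝from (⌜ ss ⌝from a)
⌜⌝from-++ []       ts a = refl
⌜⌝from-++ (s ∷ ss) ts a = ⌜⌝from-++ ss ts (a ⊢ₜ ⌜ s ⌝)

⌜⌝from-∷ʳ : ∀ ss x a → ⌜ ss ∷ʳ x ⌝from a ≡ ⌜ ss ⌝from a ⊢ₜ ⌜ x ⌝
⌜⌝from-∷ʳ ss x a = ⌜⌝from-++ ss (x ∷ []) a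

infix 6 _≐⋁_

_≐⋁_ : Term → List Sequence → Formula
X ≐⋁ ts = ⋁ (map (λ t → X ≐ ⌜ t ⌝) ts)

substF-≐⋁ : ∀ σ X ts → substF σ (X ≐⋁ ts) ≡ substT σ X ≐⋁ ts
substF-≐⋁ σ X []       = refl
substF-≐⋁ σ X (t ∷ ts) =
  cong₂ (λ u φ → ¬' (substT σ X ≐ u) ⇒ φ) (substT-⌜⌝ σ t) (substF-≐⋁ σ X ts)

take-++ : ∀ {A : Set} k (xs ys : List A) → k ≤ length xs → take k (xs ++ ys) ≡ take k xs
take-++ zero    xs       ys _         = refl
take-++ (suc k) (x ∷ xs) ys (s≤s k≤n) = cong (x ∷_) (take-++ k xs ys k≤n)

take∈I : ∀ {k} ss → k ≤ length ss → node (take k ss) ∈ I (node ss)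
take∈I ss k≤n = ∈-map⁺ (λ k → node (take k ss)) (∈-upTo⁺ (s≤s k≤n))

self∈I : ∀ ss → node ss ∈ I (node ss)
self∈I ss = subst (λ xs → node xs ∈ I (node ss)) (take-all (length ss) ss ≤-refl)
  (take∈I ss ≤-refl)

I-∷ʳ⁺ : ∀ {t} ss x → t ∈ I (node ss) → t ∈ I (node (ss ∷ʳ x))
I-∷ʳ⁺ ss x t∈ with ∈-map⁻ (λ k → node (take k ss)) {xs = upTo (suc (length ss))} t∈
... | k , k∈ , refl with ∈-upTo⁻ k∈
... | s≤s k≤n = subst (λ xs → node xs ∈ I (node (ss ∷ʳ x))) (take-++ k ss (x ∷ []) k≤n)
  (take∈I (ss ∷ʳ x) (≤-trans k≤n (length-++-≤ˡ ss)))

module Derived (T : Theory) where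

  infix  2 _⊩_
  infixl 5 _·_

  -- Derivations from local hypotheses Γ; the deduction theorem discharges them.
  data _⊩_ (Γ : List Formula) : Formula → Set where
    hyp : ∀ {φ} → φ ∈ Γ → Γ ⊩ φ
    thm : ∀ {φ} → T ⊢ φ → Γ ⊩ φ
    _·_ : ∀ {φ ψ} → Γ ⊩ φ ⇒ ψ → Γ ⊩ φ → Γ ⊩ ψ

  h0 : ∀ {Γ φ} → φ ∷ Γ ⊩ φ
  h0 = hyp (here refl)

  h1 : ∀ {Γ φ ψ₀} → ψ₀ ∷ φ ∷ Γ ⊩ φ
  h1 = hyp (there (here refl))

  h2 : ∀ {Γ φ ψ₀ ψ₁} → ψ₀ ∷ ψ₁ ∷ φ ∷ Γ ⊩ φ
  h2 = hyp (there (there (here refl)))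

  h4 : ∀ {Γ φ ψ₀ ψ₁ ψ₂ ψ₃} → ψ₀ ∷ ψ₁ ∷ ψ₂ ∷ ψ₃ ∷ φ ∷ Γ ⊩ φ
  h4 = hyp (there (there (there (there (here refl)))))

  ⇒-refl : ∀ {φ} → T ⊢ φ ⇒ φ
  ⇒-refl {φ} = mp (mp ax-S (ax-K {ψ = φ ⇒ φ})) (ax-K {ψ = φ})

  ⇒-intro : ∀ {Γ φ ψ} → φ ∷ Γ ⊩ ψ → Γ ⊩ φ ⇒ ψ
  ⇒-intro (hyp (here refl)) = thm ⇒-refl
  ⇒-intro (hyp (there φ∈)) = thm ax-K · hyp φ∈
  ⇒-intro (thm d)           = thm ax-K · thm d
  ⇒-intro (d · d′)          = thm ax-S · ⇒-intro d · ⇒-intro d′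

  ⊩⇒⊢ : ∀ {φ} → [] ⊩ φ → T ⊢ φ
  ⊩⇒⊢ (hyp ())
  ⊩⇒⊢ (thm d)  = d
  ⊩⇒⊢ (d · d′) = mp (⊩⇒⊢ d) (⊩⇒⊢ d′)

  ⊥'-elim : ∀ {φ} → T ⊢ ⊥' ⇒ φ
  ⊥'-elim = ⊩⇒⊢ (⇒-intro (thm ax-DN · ⇒-intro h1))

  ∨'-introˡ : ∀ {φ ψ} → T ⊢ φ ⇒ φ ∨' ψ
  ∨'-introˡ = ⊩⇒⊢ (⇒-intro (⇒-intro (thm ⊥'-elim · (h0 · h1))))

  ∨'-introʳ : ∀ {φ ψ} → T ⊢ ψ ⇒ φ ∨' ψ
  ∨'-introʳ = ⊩⇒⊢ (⇒-intro (⇒-intro h1))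

  ∨'-elim : ∀ {φ ψ χ} → T ⊢ (φ ⇒ χ) ⇒ (ψ ⇒ χ) ⇒ φ ∨' ψ ⇒ χ
  ∨'-elim = ⊩⇒⊢ (⇒-intro (⇒-intro (⇒-intro (thm ax-DN · ⇒-intro
    (h0 · (h2 · (h1 · ⇒-intro (h1 · (h4 · h0)))))))))

  ∧'-elimˡ : ∀ {φ ψ} → T ⊢ φ ∧' ψ ⇒ φ
  ∧'-elimˡ = ⊩⇒⊢ (⇒-intro (thm ax-DN · ⇒-intro (h1 · ⇒-intro (thm ⊥'-elim · (h1 · h0)))))

  ∧'-elimʳ : ∀ {φ ψ} → T ⊢ φ ∧' ψ ⇒ ψ
  ∧'-elimʳ = ⊩⇒⊢ (⇒-intro (thm ax-DN · ⇒-intro (h1 · ⇒-intro h1)))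

  ∃'-elim : ∀ {φ ψ} → T ⊢ φ ⇒ ↑ ψ → T ⊢ ∃' φ ⇒ ψ
  ∃'-elim {φ} {ψ} d = ⊩⇒⊢ (⇒-intro (thm ax-DN · ⇒-intro (h1 · (thm ¬ψ⇒∀¬φ · h0))))
    where
    ¬ψ⇒∀¬φ : T ⊢ ¬' ψ ⇒ ∀' (¬' φ)
    ¬ψ⇒∀¬φ = mp ax-∀D (gen (⊩⇒⊢ (⇒-intro (⇒-intro (h1 · (thm d · h0))))))

  ⊢-substF-var : ∀ {φ} → T ⊢ φ → T ⊢ substF var φ
  ⊢-substF-var {φ} = subst (T ⊢_) (sym (substF-id (λ _ → refl) φ))

  -- Stated for substituted formulas so that instantiations of nested quantifiers chain.
  ∀'-elim : ∀ {σ} φ → T ⊢ substF σ (∀' φ) → (t : Term) → T ⊢ substF (t ∷ₛ σ) φ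
  ∀'-elim {σ} φ d t = subst (T ⊢_) (trans (substF-fusion (single t) (exts σ) φ) (substF-ext single⊙exts φ))
    (mp (ax-∀E t) d)
    where
    single⊙exts : ∀ n → (single t ⊙ exts σ) n ≡ (t ∷ₛ σ) n
    single⊙exts zero    = refl
    single⊙exts (suc n) = substT-single-shiftT t (σ n)

  ≐-sym : ∀ a b → T ⊢ a ≐ b ⇒ b ≐ a
  ≐-sym a b = ⊩⇒⊢ (⇒-intro (thm leibniz · h0 · thm (ax-≐R a)))
    where
    leibniz : T ⊢ a ≐ b ⇒ a ≐ a ⇒ b ≐ a
    leibniz = subst₂ (λ u v → T ⊢ a ≐ b ⇒ a ≐ u ⇒ b ≐ v)
      (substT-single-shiftT a a) (substT-single-shiftT b a) (ax-≐L {φ = var 0 ≐ shiftT a} a b)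

  ≐-trans : ∀ a b c → T ⊢ a ≐ b ⇒ b ≐ c ⇒ a ≐ c
  ≐-trans a b c = ⊩⇒⊢ (⇒-intro (⇒-intro (thm b≐c⇒a≐b⇒a≐c · h0 · h1)))
    where
    b≐c⇒a≐b⇒a≐c : T ⊢ b ≐ c ⇒ a ≐ b ⇒ a ≐ c
    b≐c⇒a≐b⇒a≐c = subst₂ (λ u v → T ⊢ b ≐ c ⇒ u ≐ b ⇒ v ≐ c)
      (substT-single-shiftT b a) (substT-single-shiftT c a) (ax-≐L {φ = shiftT a ≐ var 0} b c)

  ≐-cong : ∀ C a b → T ⊢ a ≐ b ⇒ substT (single a) C ≐ substT (single b) C
  ≐-cong C a b = ⊩⇒⊢ (⇒-intro (thm leibniz · h0 · thm (ax-≐R Ca)))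
    where
    Ca = substT (single a) C
    leibniz : T ⊢ a ≐ b ⇒ Ca ≐ Ca ⇒ Ca ≐ substT (single b) C
    leibniz = subst₂ (λ u v → T ⊢ a ≐ b ⇒ u ≐ Ca ⇒ v ≐ substT (single b) C)
      (substT-single-shiftT a Ca) (substT-single-shiftT b Ca) (ax-≐L {φ = shiftT Ca ≐ C} a b)

  ≐-cong-∘ʳ : ∀ x a b → T ⊢ a ≐ b ⇒ x ∘ₜ a ≐ x ∘ₜ b
  ≐-cong-∘ʳ x a b = subst₂ (λ u v → T ⊢ a ≐ b ⇒ u ∘ₜ a ≐ v ∘ₜ b)
    (substT-single-shiftT a x) (substT-single-shiftT b x) (≐-cong (shiftT x ∘ₜ var 0) a b)

  ≐-cong-⊢ˡ : ∀ x a b → T ⊢ a ≐ b ⇒ a ⊢ₜ x ≐ b ⊢ₜ x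
  ≐-cong-⊢ˡ x a b = subst₂ (λ u v → T ⊢ a ≐ b ⇒ a ⊢ₜ u ≐ b ⊢ₜ v)
    (substT-single-shiftT a x) (substT-single-shiftT b x) (≐-cong (var 0 ⊢ₜ shiftT x) a b)

⊢-translate : ∀ {T T′ : Theory} → (∀ {φ} → T φ → T′ ⊢ φ) → ∀ {φ} → T ⊢ φ → T′ ⊢ φ
⊢-translate axioms (ax a)      = axioms a
⊢-translate axioms ax-K        = ax-K
⊢-translate axioms ax-S        = ax-S
⊢-translate axioms ax-DN       = ax-DN
⊢-translate axioms (ax-∀E t)   = ax-∀E t
⊢-translate axioms ax-∀D       = ax-∀D
⊢-translate axioms (ax-≐R t)   = ax-≐R t
⊢-translate axioms (ax-≐L s t) = ax-≐L s t
⊢-translate axioms (mp d d′)   = mp (⊢-translate axioms d) (⊢-translate axioms d′)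
⊢-translate axioms (gen d)     = gen (⊢-translate axioms d)

open Derived Seq

⊢ₜ≢e : ∀ a b → Seq ⊢ ¬' (a ⊢ₜ b ≐ e)
⊢ₜ≢e a b = ∀'-elim {a ∷ₛ var} B (∀'-elim {var} (∀' B) (⊢-substF-var (ax seq₁)) a) b
  where B = ¬' ((var 1 ⊢ₜ var 0) ≐ e)

⊢ₜ-injective : ∀ a₁ a₂ b₁ b₂ → Seq ⊢ a₁ ⊢ₜ a₂ ≐ b₁ ⊢ₜ b₂ ⇒ (a₁ ≐ b₁) ∧' (a₂ ≐ b₂)
⊢ₜ-injective a₁ a₂ b₁ b₂ =
  ∀'-elim {b₁ ∷ₛ a₂ ∷ₛ a₁ ∷ₛ var} B (∀'-elim {a₂ ∷ₛ a₁ ∷ₛ var} (∀' B)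
    (∀'-elim {a₁ ∷ₛ var} (∀' (∀' B)) (∀'-elim {var} (∀' (∀' (∀' B))) (⊢-substF-var (ax seq₂)) a₁) a₂) b₁) b₂
  where B = ((var 3 ⊢ₜ var 2) ≐ (var 1 ⊢ₜ var 0)) ⇒ ((var 3 ≐ var 1) ∧' (var 2 ≐ var 0))

∘-identityʳ : ∀ a → Seq ⊢ a ∘ₜ e ≐ a
∘-identityʳ = ∀'-elim {var} ((var 0 ∘ₜ e) ≐ var 0) (⊢-substF-var (ax seq₃))

∘-⊢ₜ : ∀ a b c → Seq ⊢ a ∘ₜ (b ⊢ₜ c) ≐ (a ∘ₜ b) ⊢ₜ c
∘-⊢ₜ a b c = ∀'-elim {b ∷ₛ a ∷ₛ var} B
  (∀'-elim {a ∷ₛ var} (∀' B) (∀'-elim {var} (∀' (∀' B)) (⊢-substF-var (ax seq₄)) a) b) c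
  where B = (var 2 ∘ₜ (var 1 ⊢ₜ var 0)) ≐ ((var 2 ∘ₜ var 1) ⊢ₜ var 0)

≐e-or-≐⊢ₜ : ∀ a → Seq ⊢ (a ≐ e) ∨' ∃' (∃' (shiftT (shiftT a) ≐ var 1 ⊢ₜ var 0))
≐e-or-≐⊢ₜ = ∀'-elim {var} ((var 0 ≐ e) ∨' ∃' (∃' (var 2 ≐ (var 1 ⊢ₜ var 0)))) (⊢-substF-var (ax seq₅))

∘-⊢ₜ-≐ : ∀ x y₁ y₂ s → Seq ⊢ x ∘ₜ (y₁ ⊢ₜ y₂) ≐ s ⇒ (x ∘ₜ y₁) ⊢ₜ y₂ ≐ s
∘-⊢ₜ-≐ x y₁ y₂ s = ⊩⇒⊢ (⇒-intro
  (thm (≐-trans _ _ _) · (thm (≐-sym _ _) · thm (∘-⊢ₜ x y₁ y₂)) · h0))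

⊢ₜ-≢ˡ : ∀ {a₁ a₂ b₁ b₂} → Seq ⊢ ¬' (a₁ ≐ b₁) → Seq ⊢ ¬' (a₁ ⊢ₜ a₂ ≐ b₁ ⊢ₜ b₂)
⊢ₜ-≢ˡ a₁≢b₁ = ⊩⇒⊢ (⇒-intro (thm a₁≢b₁ · (thm ∧'-elimˡ · (thm (⊢ₜ-injective _ _ _ _) · h0))))

⊢ₜ-≢ʳ : ∀ {a₁ a₂ b₁ b₂} → Seq ⊢ ¬' (a₂ ≐ b₂) → Seq ⊢ ¬' (a₁ ⊢ₜ a₂ ≐ b₁ ⊢ₜ b₂)
⊢ₜ-≢ʳ a₂≢b₂ = ⊩⇒⊢ (⇒-intro (thm a₂≢b₂ · (thm ∧'-elimʳ · (thm (⊢ₜ-injective _ _ _ _) · h0))))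

∘-⌜⌝from : ∀ ts acc a b → Seq ⊢ a ∘ₜ acc ≐ b → Seq ⊢ a ∘ₜ ⌜ ts ⌝from acc ≐ ⌜ ts ⌝from b
∘-⌜⌝from []       acc a b d = d
∘-⌜⌝from (t ∷ ts) acc a b d = ∘-⌜⌝from ts (acc ⊢ₜ ⌜ t ⌝) a (b ⊢ₜ ⌜ t ⌝)
  (mp (mp (≐-trans _ _ _) (∘-⊢ₜ a acc ⌜ t ⌝)) (mp (≐-cong-⊢ˡ ⌜ t ⌝ _ _) d))

⌜⌝-∘ : ∀ ss ts → Seq ⊢ ⌜ node ss ⌝ ∘ₜ ⌜ node ts ⌝ ≐ ⌜ node (ss ++ ts) ⌝
⌜⌝-∘ ss ts = subst (λ u → Seq ⊢ ⌜ node ss ⌝ ∘ₜ ⌜ node ts ⌝ ≐ u) (sym (⌜⌝from-++ ss ts e))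
  (∘-⌜⌝from ts e ⌜ node ss ⌝ ⌜ node ss ⌝ (∘-identityʳ _))

Separated : Sequence → Set
Separated s = ∀ t → s ≡ t ⊎ Seq ⊢ ¬' (⌜ s ⌝ ≐ ⌜ t ⌝)

separated-from : ∀ {ss ts} → Reverse ss → Reverse ts → All Separated ss →
                 ss ≡ ts ⊎ Seq ⊢ ¬' (⌜ ss ⌝from e ≐ ⌜ ts ⌝from e)
separated-from [] [] _ = inj₁ refl
separated-from [] (ys ∶ _ ∶ʳ y) _ =
  inj₂ (subst (λ u → Seq ⊢ ¬' (e ≐ u)) (sym (⌜⌝from-∷ʳ ys y e))
    (⊩⇒⊢ (⇒-intro (thm (⊢ₜ≢e _ _) · (thm (≐-sym _ _) · h0)))))
separated-from (xs ∶ _ ∶ʳ x) [] _ =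
  inj₂ (subst (λ u → Seq ⊢ ¬' (u ≐ e)) (sym (⌜⌝from-∷ʳ xs x e)) (⊢ₜ≢e _ _))
separated-from (xs ∶ vs ∶ʳ x) (ys ∶ vt ∶ʳ y) sep with ++⁻ xs sep
... | sep-xs , sep-x ∷ [] = snoc (separated-from vs vt sep-xs) (sep-x y)
  where
  ⌜∷ʳ⌝ : Seq ⊢ ¬' (⌜ xs ⌝from e ⊢ₜ ⌜ x ⌝ ≐ ⌜ ys ⌝from e ⊢ₜ ⌜ y ⌝) →
         Seq ⊢ ¬' (⌜ xs ∷ʳ x ⌝from e ≐ ⌜ ys ∷ʳ y ⌝from e)
  ⌜∷ʳ⌝ = subst₂ (λ u v → Seq ⊢ ¬' (u ≐ v)) (sym (⌜⌝from-∷ʳ xs x e)) (sym (⌜⌝from-∷ʳ ys y e))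
  snoc : xs ≡ ys ⊎ Seq ⊢ ¬' (⌜ xs ⌝from e ≐ ⌜ ys ⌝from e) → x ≡ y ⊎ Seq ⊢ ¬' (⌜ x ⌝ ≐ ⌜ y ⌝) →
         xs ∷ʳ x ≡ ys ∷ʳ y ⊎ Seq ⊢ ¬' (⌜ xs ∷ʳ x ⌝from e ≐ ⌜ ys ∷ʳ y ⌝from e)
  snoc (inj₁ refl) (inj₁ refl) = inj₁ refl
  snoc (inj₂ xs≢ys) _          = inj₂ (⌜∷ʳ⌝ (⊢ₜ-≢ˡ xs≢ys))
  snoc _          (inj₂ x≢y)   = inj₂ (⌜∷ʳ⌝ (⊢ₜ-≢ʳ x≢y))

mutual
  separated : ∀ s → Separated s
  separated (node ss) (node ts) =
    map₁ (cong node) (separated-from (reverseView ss) (reverseView ts) (all-separated ss))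

  all-separated : ∀ ss → All Separated ss
  all-separated []       = []
  all-separated (s ∷ ss) = separated s ∷ all-separated ss

⌜⌝-distinct : ∀ s t → s ≢ t → Seq ⊢ ¬' (⌜ s ⌝ ≐ ⌜ t ⌝)
⌜⌝-distinct s t s≢t with separated s t
... | inj₁ s≡t  = ⊥-elim (s≢t s≡t)
... | inj₂ s≠t = s≠t

≐⋁-intro : ∀ {t ts} X → t ∈ ts → Seq ⊢ X ≐ ⌜ t ⌝ ⇒ X ≐⋁ ts
≐⋁-intro X (here refl) = ∨'-introˡ
≐⋁-intro X (there t∈)  = ⊩⇒⊢ (⇒-intro (thm ∨'-introʳ · (thm (≐⋁-intro X t∈) · h0)))

≐⋁-mono : ∀ ts us X → (∀ {t} → t ∈ ts → t ∈ us) → Seq ⊢ X ≐⋁ ts ⇒ X ≐⋁ us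
≐⋁-mono []       us X _   = ⊥'-elim
≐⋁-mono (t ∷ ts) us X ⊆us =
  mp (mp ∨'-elim (≐⋁-intro X (⊆us (here refl)))) (≐⋁-mono ts us X (λ t∈ → ⊆us (there t∈)))

mutual
  ∘-≐⌜⌝ : ∀ {ss} → Reverse ss → ∀ X Y → Seq ⊢ X ∘ₜ Y ≐ ⌜ node ss ⌝ ⇒ X ≐⋁ I (node ss)
  ∘-≐⌜⌝ {ss} v X Y = mp (mp (mp ∨'-elim Y≐e-case) Y≐⊢-case) (≐e-or-≐⊢ₜ Y)
    where
    S = ⌜ node ss ⌝
    X′ = shiftT (shiftT X)
    Y′ = shiftT (shiftT Y)
    Y≐e-case : Seq ⊢ Y ≐ e ⇒ X ∘ₜ Y ≐ S ⇒ X ≐⋁ I (node ss)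
    Y≐e-case = ⊩⇒⊢ (⇒-intro (⇒-intro (thm (≐⋁-intro X (self∈I ss)) ·
      (thm (≐-trans _ _ _) · thm (mp (≐-sym _ _) (∘-identityʳ X)) ·
        (thm (≐-trans _ _ _) · (thm (≐-cong-∘ʳ X e Y) · (thm (≐-sym _ _) · h1)) · h0)))))
    body : Seq ⊢ Y′ ≐ var 1 ⊢ₜ var 0 ⇒ X′ ∘ₜ Y′ ≐ S ⇒ X′ ≐⋁ I (node ss)
    body = ⊩⇒⊢ (⇒-intro (⇒-intro (thm (∘⊢ₜ-≐⌜⌝ v X′ (var 1) (var 0)) ·
      (thm (≐-trans _ _ _) · (thm (≐-sym _ _) · (thm (≐-cong-∘ʳ X′ _ _) · h1)) · h0))))
    ↑↑ : (X′ ∘ₜ Y′ ≐ S ⇒ X′ ≐⋁ I (node ss)) ≡ ↑ (↑ (X ∘ₜ Y ≐ S ⇒ X ≐⋁ I (node ss)))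
    ↑↑ = sym (cong₂ (λ u φ → X′ ∘ₜ Y′ ≐ u ⇒ φ)
      (trans (cong shiftT (substT-⌜⌝ _ (node ss))) (substT-⌜⌝ _ (node ss)))
      (trans (cong ↑ (substF-≐⋁ _ X (I (node ss)))) (substF-≐⋁ _ (shiftT X) (I (node ss)))))
    Y≐⊢-case : Seq ⊢ ∃' (∃' (Y′ ≐ var 1 ⊢ₜ var 0)) ⇒ X ∘ₜ Y ≐ S ⇒ X ≐⋁ I (node ss)
    Y≐⊢-case = ∃'-elim (∃'-elim (subst (λ φ → Seq ⊢ Y′ ≐ var 1 ⊢ₜ var 0 ⇒ φ) ↑↑ body))

  ∘⊢ₜ-≐⌜⌝ : ∀ {ss} → Reverse ss → ∀ X Y₁ Y₂ →
            Seq ⊢ X ∘ₜ (Y₁ ⊢ₜ Y₂) ≐ ⌜ node ss ⌝ ⇒ X ≐⋁ I (node ss)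
  ∘⊢ₜ-≐⌜⌝ [] X Y₁ Y₂ =
    ⊩⇒⊢ (⇒-intro (thm ⊥'-elim · (thm (⊢ₜ≢e _ _) · (thm (∘-⊢ₜ-≐ X Y₁ Y₂ e) · h0))))
  ∘⊢ₜ-≐⌜⌝ (xs ∶ v ∶ʳ x) X Y₁ Y₂ =
    subst (λ u → Seq ⊢ X ∘ₜ (Y₁ ⊢ₜ Y₂) ≐ u ⇒ X ≐⋁ I (node (xs ∷ʳ x))) (sym (⌜⌝from-∷ʳ xs x e))
      (⊩⇒⊢ (⇒-intro (thm (≐⋁-mono _ _ X (I-∷ʳ⁺ xs x)) · (thm (∘-≐⌜⌝ v X Y₁) ·
        (thm ∧'-elimˡ · (thm (⊢ₜ-injective _ _ _ _) · (thm (∘-⊢ₜ-≐ X Y₁ Y₂ _) · h0)))))))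

⊑⌜⌝ : ∀ s → Seq ⊢ ∀' (var 0 ⊑ ⌜ s ⌝ ⇒ var 0 ≐⋁ I s)
⊑⌜⌝ (node ss) = gen (∃'-elim (subst₂ (λ u φ → Seq ⊢ var 1 ∘ₜ var 0 ≐ u ⇒ φ)
  (sym (substT-⌜⌝ _ (node ss))) (sym (substF-≐⋁ _ (var 0) (I (node ss))))
  (∘-≐⌜⌝ (reverseView ss) (var 1) (var 0))))

WSeq-axioms-in-Seq : ∀ {φ} → WSeq φ → Seq ⊢ φ
WSeq-axioms-in-Seq (wseq₁ s t s≢t) = ⌜⌝-distinct s t s≢t
WSeq-axioms-in-Seq (wseq₂ ss ts)   = ⌜⌝-∘ ss ts
WSeq-axioms-in-Seq (wseq₃ s)       = ⊑⌜⌝ s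

theorem3 : ∀ (φ : Formula) → WSeq ⊢ φ → Seq ⊢ φ
theorem3 _ = ⊢-translate WSeq-axioms-in-Seq
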